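{- Let $\mathcal{C}$ be a locally cartesian closed category with a map $\pi\colon\widetilde{\mathcal{U}}\to\mathcal{U}$ and a monomorphism $\iota\colon\partial\mathsf{Cof}\hookrightarrow\mathsf{Cof}$, and suppose there is a $\iota$-cofibrant structure on $\pi$-sections. If $E\to B$ is a $\pi$-fibration and $s\colon B\to E$ is a section of it, then $s$ is an $\iota$-cofibration.
   Context: A $\pi$-fibration is a map $E\to B$ that arises as a pullback of $\pi$ along some map $B\to\mathcal{U}$; an $\iota$-cofibration is a map arising as a pullback of $\iota$ along some map into $\mathsf{Cof}$. A $\iota$-cofibrant structure on $\pi$-sections is a pair of maps $\mathsf{eq}\colon\widetilde{\mathcal{U}}\to\partial\mathsf{Cof}$ and $\mathsf{isEq}\colon\widetilde{\mathcal{U}}\times_{\mathcal{U}}\widetilde{\mathcal{U}}\to\mathsf{Cof}$ making the square with the diagonal $\Delta\colon\widetilde{\mathcal{U}}\to\widetilde{\mathcal{U}}\times_{\mathcal{U}}\widetilde{\mathcal{U}}$ on the left and $\iota$ on the right a pullback square. -}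

module Defs where

open import Level using (Level; _⊔_) renaming (suc to lsuc)
open import Data.Product using (Σ; _×_; _,_; proj₁; proj₂; ∃-syntax)
open import Relation.Binary.PropositionalEquality using (_≡_)

record Category (o ℓ : Level) : Set (lsuc (o ⊔ ℓ)) where
  infixr 9 _∘_
  field
    Obj       : Set o
    Hom       : Obj → Obj → Set ℓ
    id        : ∀ {A} → Hom A A
    _∘_       : ∀ {A B C} → Hom B C → Hom A B → Hom A C
    identityˡ : ∀ {A B} {f : Hom A B} → id ∘ f ≡ f
    identityʳ : ∀ {A B} {f : Hom A B} → f ∘ id ≡ f
    assoc     : ∀ {A B C D} {f : Hom A B} {g : Hom B C} {h : Hom C D} →
                (h ∘ g) ∘ f ≡ h ∘ (g ∘ f)

module _ {o ℓ : Level} (𝒞 : Category o ℓ) where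
  open Category 𝒞

  Mono : ∀ {A B} → Hom A B → Set (o ⊔ ℓ)
  Mono {A} m = ∀ {X} (u v : Hom X A) → m ∘ u ≡ m ∘ v → u ≡ v

  record IsPullback {P A B C : Obj} (f : Hom A C) (g : Hom B C)
                    (p₁ : Hom P A) (p₂ : Hom P B) : Set (o ⊔ ℓ) where
    field
      commute   : f ∘ p₁ ≡ g ∘ p₂
      universal : ∀ {Q} (q₁ : Hom Q A) (q₂ : Hom Q B) → f ∘ q₁ ≡ g ∘ q₂ →
                  Σ (Hom Q P) λ u → (p₁ ∘ u ≡ q₁) × (p₂ ∘ u ≡ q₂) ×
                    (∀ (v : Hom Q P) → p₁ ∘ v ≡ q₁ → p₂ ∘ v ≡ q₂ → v ≡ u)

  record Pullback {A B C : Obj} (f : Hom A C) (g : Hom B C) : Set (o ⊔ ℓ) where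
    field
      P          : Obj
      p₁         : Hom P A
      p₂         : Hom P B
      isPullback : IsPullback f g p₁ p₂

  HasPullbacks : Set (o ⊔ ℓ)
  HasPullbacks = ∀ {A B C} (f : Hom A C) (g : Hom B C) → Pullback f g

  -- Exponentials in the slice 𝒞/I, given chosen pullbacks (which are the
  -- binary products of 𝒞/I).
  module _ (pb : HasPullbacks) where
    private
      module PB {A B C} (f : Hom A C) (g : Hom B C) = Pullback (pb f g)

    record SliceExponential {I X Y : Obj} (p : Hom X I) (q : Hom Y I)
           : Set (o ⊔ ℓ) where
      field
        Z   : Obj
        r   : Hom Z I
        ev  : Hom (PB.P r p) Y
        ev-over : q ∘ ev ≡ r ∘ PB.p₁ r p
        curry : ∀ {W} (w : Hom W I) (g : Hom (PB.P w p) Y) →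
                q ∘ g ≡ w ∘ PB.p₁ w p →
                Σ (Hom W Z) λ h → (r ∘ h ≡ w) ×
                  -- ev ∘ (h ×_I X) ≡ g, where h ×_I X is any (hence the unique)
                  -- map W ×_I X → Z ×_I X with the expected projections
                  (∀ (k : Hom (PB.P w p) (PB.P r p)) →
                     PB.p₁ r p ∘ k ≡ h ∘ PB.p₁ w p → PB.p₂ r p ∘ k ≡ PB.p₂ w p →
                     ev ∘ k ≡ g) ×
                  (∀ (h' : Hom W Z) → r ∘ h' ≡ w →
                     (∀ (k : Hom (PB.P w p) (PB.P r p)) →
                        PB.p₁ r p ∘ k ≡ h' ∘ PB.p₁ w p → PB.p₂ r p ∘ k ≡ PB.p₂ w p →
                        ev ∘ k ≡ g) →
                     h' ≡ h)

  -- Locally cartesian closed: pullbacks exist (so every slice has binary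
  -- products; slices always have a terminal object) and every slice has
  -- exponentials, i.e. every slice is cartesian closed.
  record LCCC : Set (o ⊔ ℓ) where
    field
      pullbacks    : HasPullbacks
      exponentials : ∀ {I X Y} (p : Hom X I) (q : Hom Y I) →
                     SliceExponential pullbacks p q

  IsFibration : ∀ {Ũ U} (π : Hom Ũ U) {E B} (p : Hom E B) → Set (o ⊔ ℓ)
  IsFibration {Ũ} {U} π {E} {B} p =
    Σ (Hom B U) λ χ → Σ (Hom E Ũ) λ q → IsPullback χ π p q

  IsCofibration : ∀ {∂Cof Cof} (ι : Hom ∂Cof Cof) {A X} (m : Hom A X) → Set (o ⊔ ℓ)
  IsCofibration {∂Cof} {Cof} ι {A} {X} m =
    Σ (Hom X Cof) λ χ → Σ (Hom A ∂Cof) λ q → IsPullback χ ι m q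

  module _ (lccc : LCCC) where
    open LCCC lccc

    module Fib {Ũ U} (π : Hom Ũ U) = Pullback (pullbacks π π)

    diagonal : ∀ {Ũ U} (π : Hom Ũ U) → Hom Ũ (Fib.P π)
    diagonal π = proj₁ (IsPullback.universal (Fib.isPullback π) id id _≡_.refl)

    record CofibrantStructure {Ũ U ∂Cof Cof} (π : Hom Ũ U) (ι : Hom ∂Cof Cof)
           : Set (o ⊔ ℓ) where
      field
        eq        : Hom Ũ ∂Cof
        isEq      : Hom (Fib.P π) Cof
        isPullback : IsPullback isEq ι (diagonal π) eq

{-# OPTIONS --safe #-}
-- A section s of p is the equaliser of id and s ∘ p.  When p is the pullback
-- of π along χ with projection q : E → Ũ, a map a into E is fixed by s ∘ p
-- exactly when q ∘ s ∘ p ∘ a = q ∘ a, so s is the pullback of the diagonal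
-- Δ : Ũ → Ũ ×_U Ũ along ⟨q , q ∘ s ∘ p⟩.  The cofibrant structure makes Δ a
-- pullback of ι, and pasting the two pullback squares makes s one as well.
module Submission where

open import Level using (_⊔_)
open import Data.Product using (Σ; _×_; _,_; proj₁; proj₂)
open import Relation.Binary.PropositionalEquality
  using (_≡_; refl; sym; trans; cong; module ≡-Reasoning)

open import Defs

module _ {o ℓ} (𝒞 : Category o ℓ) where
  open Category 𝒞
  open ≡-Reasoning

  private
    pullˡ : ∀ {A B C D} {f : Hom A B} {g : Hom B C} {h : Hom A C} {k : Hom D A} →
            g ∘ f ≡ h → g ∘ (f ∘ k) ≡ h ∘ k
    pullˡ {k = k} gf≡h = trans (sym assoc) (cong (_∘ k) gf≡h)

    extendʳ : ∀ {A B B' C D} {a : Hom B C} {b : Hom A B} {c : Hom B' C} {d : Hom A B'}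
                {k : Hom D A} → a ∘ b ≡ c ∘ d → a ∘ (b ∘ k) ≡ c ∘ (d ∘ k)
    extendʳ sq = trans (pullˡ sq) assoc

    cancelˡ : ∀ {A B D} {f : Hom A B} {g : Hom B A} {k : Hom D A} →
              g ∘ f ≡ id → g ∘ (f ∘ k) ≡ k
    cancelˡ gf≡id = trans (pullˡ gf≡id) identityˡ

  JointlyMonic : ∀ {P A B} → Hom P A → Hom P B → Set (o ⊔ ℓ)
  JointlyMonic {P} p₁ p₂ =
    ∀ {Q} {u v : Hom Q P} → p₁ ∘ u ≡ p₁ ∘ v → p₂ ∘ u ≡ p₂ ∘ v → u ≡ v

  section⇒Mono : ∀ {B E} {p : Hom E B} {s : Hom B E} → p ∘ s ≡ id → Mono 𝒞 s
  section⇒Mono {p = p} {s} ps≡id u v su≡sv = begin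
    u             ≡⟨ sym (cancelˡ ps≡id) ⟩
    p ∘ (s ∘ u)   ≡⟨ cong (p ∘_) su≡sv ⟩
    p ∘ (s ∘ v)   ≡⟨ cancelˡ ps≡id ⟩
    v             ∎

  module _ {P A B C} {f : Hom A C} {g : Hom B C} {p₁ : Hom P A} {p₂ : Hom P B} where

    IsPullback-intro :
      f ∘ p₁ ≡ g ∘ p₂ →
      (∀ {Q} (q₁ : Hom Q A) (q₂ : Hom Q B) → f ∘ q₁ ≡ g ∘ q₂ →
         Σ (Hom Q P) λ u → (p₁ ∘ u ≡ q₁) × (p₂ ∘ u ≡ q₂)) →
      JointlyMonic p₁ p₂ →
      IsPullback 𝒞 f g p₁ p₂
    IsPullback-intro commute mediate monic = record
      { commute   = commute
      ; universal = λ q₁ q₂ sq →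
          let (u , p₁u≡q₁ , p₂u≡q₂) = mediate q₁ q₂ sq in
          u , p₁u≡q₁ , p₂u≡q₂ ,
          λ v p₁v≡q₁ p₂v≡q₂ → monic (trans p₁v≡q₁ (sym p₁u≡q₁)) (trans p₂v≡q₂ (sym p₂u≡q₂))
      }

    module _ (pb : IsPullback 𝒞 f g p₁ p₂) where
      open IsPullback pb

      mediator : ∀ {Q} {q₁ : Hom Q A} {q₂ : Hom Q B} → f ∘ q₁ ≡ g ∘ q₂ → Hom Q P
      mediator sq = proj₁ (universal _ _ sq)

      p₁∘mediator : ∀ {Q} {q₁ : Hom Q A} {q₂ : Hom Q B} (sq : f ∘ q₁ ≡ g ∘ q₂) →
                    p₁ ∘ mediator sq ≡ q₁
      p₁∘mediator sq = proj₁ (proj₂ (universal _ _ sq))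

      p₂∘mediator : ∀ {Q} {q₁ : Hom Q A} {q₂ : Hom Q B} (sq : f ∘ q₁ ≡ g ∘ q₂) →
                    p₂ ∘ mediator sq ≡ q₂
      p₂∘mediator sq = proj₁ (proj₂ (proj₂ (universal _ _ sq)))

      IsPullback⇒JointlyMonic : JointlyMonic p₁ p₂
      IsPullback⇒JointlyMonic {u = u} {v} p₁u≡p₁v p₂u≡p₂v =
        trans (unique u p₁u≡p₁v p₂u≡p₂v) (sym (unique v refl refl))
        where
        unique : ∀ w → p₁ ∘ w ≡ p₁ ∘ v → p₂ ∘ w ≡ p₂ ∘ v → w ≡ mediator (extendʳ commute)
        unique = proj₂ (proj₂ (proj₂ (universal _ _ (extendʳ commute))))

  module _ {P A B C D R} {f : Hom A C} {g : Hom B C} {p₁ : Hom P A} {p₂ : Hom P B}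
           {h : Hom D A} {r₁ : Hom R D} {r₂ : Hom R P} where

    IsPullback-paste : IsPullback 𝒞 f g p₁ p₂ → IsPullback 𝒞 h p₁ r₁ r₂ →
                       IsPullback 𝒞 (f ∘ h) g r₁ (p₂ ∘ r₂)
    IsPullback-paste right left = IsPullback-intro commute mediate monic
      where
      module Right = IsPullback right
      module Left  = IsPullback left

      commute : (f ∘ h) ∘ r₁ ≡ g ∘ (p₂ ∘ r₂)
      commute = begin
        (f ∘ h) ∘ r₁    ≡⟨ assoc ⟩
        f ∘ (h ∘ r₁)    ≡⟨ cong (f ∘_) Left.commute ⟩
        f ∘ (p₁ ∘ r₂)   ≡⟨ extendʳ Right.commute ⟩
        g ∘ (p₂ ∘ r₂)   ∎

      mediate : ∀ {Q} (q₁ : Hom Q D) (q₂ : Hom Q B) → (f ∘ h) ∘ q₁ ≡ g ∘ q₂ →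
                Σ (Hom Q R) λ u → (r₁ ∘ u ≡ q₁) × ((p₂ ∘ r₂) ∘ u ≡ q₂)
      mediate q₁ q₂ sq = u , p₁∘mediator left sq-left , (begin
          (p₂ ∘ r₂) ∘ u   ≡⟨ assoc ⟩
          p₂ ∘ (r₂ ∘ u)   ≡⟨ cong (p₂ ∘_) (p₂∘mediator left sq-left) ⟩
          p₂ ∘ w          ≡⟨ p₂∘mediator right sq-right ⟩
          q₂              ∎)
        where
        sq-right : f ∘ (h ∘ q₁) ≡ g ∘ q₂
        sq-right = trans (sym assoc) sq
        w : Hom _ P
        w = mediator right sq-right
        sq-left : h ∘ q₁ ≡ p₁ ∘ w
        sq-left = sym (p₁∘mediator right sq-right)
        u : Hom _ R
        u = mediator left sq-left

      monic : JointlyMonic r₁ (p₂ ∘ r₂)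
      monic {u = u} {v} r₁u≡r₁v p₂r₂u≡p₂r₂v =
        IsPullback⇒JointlyMonic left r₁u≡r₁v
          (IsPullback⇒JointlyMonic right p₁r₂u≡p₁r₂v
            (trans (sym assoc) (trans p₂r₂u≡p₂r₂v assoc)))
        where
        p₁r₂u≡p₁r₂v : p₁ ∘ (r₂ ∘ u) ≡ p₁ ∘ (r₂ ∘ v)
        p₁r₂u≡p₁r₂v = begin
          p₁ ∘ (r₂ ∘ u)   ≡⟨ extendʳ (sym Left.commute) ⟩
          h ∘ (r₁ ∘ u)    ≡⟨ cong (h ∘_) r₁u≡r₁v ⟩
          h ∘ (r₁ ∘ v)    ≡⟨ extendʳ Left.commute ⟩
          p₁ ∘ (r₂ ∘ v)   ∎

  IsPullbackOf : ∀ {B C P A} → Hom B C → Hom P A → Set (o ⊔ ℓ)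
  IsPullbackOf {B} {C} {P} {A} g m =
    Σ (Hom A C) λ f → Σ (Hom P B) λ t → IsPullback 𝒞 f g m t

  IsPullbackOf-trans : ∀ {B C P A R D} {g : Hom B C} {m : Hom P A} {n : Hom R D} →
                       IsPullbackOf g m → IsPullbackOf m n → IsPullbackOf g n
  IsPullbackOf-trans (f , t , right) (h , r , left) = f ∘ h , t ∘ r , IsPullback-paste right left

  module _ (lccc : LCCC 𝒞) {Ũ U} (π : Hom Ũ U) where
    private
      module Ũ×Ũ = Fib 𝒞 lccc π

      Δ : Hom Ũ Ũ×Ũ.P
      Δ = diagonal 𝒞 lccc π

    p₁∘diagonal : Ũ×Ũ.p₁ ∘ Δ ≡ id
    p₁∘diagonal = p₁∘mediator Ũ×Ũ.isPullback refl

    p₂∘diagonal : Ũ×Ũ.p₂ ∘ Δ ≡ id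
    p₂∘diagonal = p₂∘mediator Ũ×Ũ.isPullback refl

    module _ {E B} {χ : Hom B U} {p : Hom E B} {q : Hom E Ũ} {s : Hom B E}
             (fib : IsPullback 𝒞 χ π p q) (ps≡id : p ∘ s ≡ id) where

      πq≡πqsp : π ∘ q ≡ π ∘ (q ∘ (s ∘ p))
      πq≡πqsp = begin
        π ∘ q               ≡⟨ sym (IsPullback.commute fib) ⟩
        χ ∘ p               ≡⟨ cong (χ ∘_) (sym (cancelˡ ps≡id)) ⟩
        χ ∘ (p ∘ (s ∘ p))   ≡⟨ extendʳ (IsPullback.commute fib) ⟩
        π ∘ (q ∘ (s ∘ p))   ∎

      ⟨q,qsp⟩ : Hom E Ũ×Ũ.P
      ⟨q,qsp⟩ = mediator Ũ×Ũ.isPullback πq≡πqsp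

      ⟨q,qsp⟩∘s≡Δ∘qs : ⟨q,qsp⟩ ∘ s ≡ Δ ∘ (q ∘ s)
      ⟨q,qsp⟩∘s≡Δ∘qs = IsPullback⇒JointlyMonic Ũ×Ũ.isPullback
        (trans (pullˡ (p₁∘mediator Ũ×Ũ.isPullback πq≡πqsp)) (sym (cancelˡ p₁∘diagonal)))
        (begin
          Ũ×Ũ.p₂ ∘ (⟨q,qsp⟩ ∘ s)   ≡⟨ pullˡ (p₂∘mediator Ũ×Ũ.isPullback πq≡πqsp) ⟩
          (q ∘ (s ∘ p)) ∘ s        ≡⟨ trans assoc (cong (q ∘_) assoc) ⟩
          q ∘ (s ∘ (p ∘ s))        ≡⟨ cong (λ k → q ∘ (s ∘ k)) ps≡id ⟩
          q ∘ (s ∘ id)             ≡⟨ cong (q ∘_) identityʳ ⟩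
          q ∘ s                    ≡⟨ sym (cancelˡ p₂∘diagonal) ⟩
          Ũ×Ũ.p₂ ∘ (Δ ∘ (q ∘ s))   ∎)

      module _ {Q} {a : Hom Q E} {b : Hom Q Ũ} (sq : ⟨q,qsp⟩ ∘ a ≡ Δ ∘ b) where

        qa≡b : q ∘ a ≡ b
        qa≡b = begin
          q ∘ a                    ≡⟨ sym (pullˡ (p₁∘mediator Ũ×Ũ.isPullback πq≡πqsp)) ⟩
          Ũ×Ũ.p₁ ∘ (⟨q,qsp⟩ ∘ a)   ≡⟨ cong (Ũ×Ũ.p₁ ∘_) sq ⟩
          Ũ×Ũ.p₁ ∘ (Δ ∘ b)         ≡⟨ cancelˡ p₁∘diagonal ⟩
          b                        ∎

        qspa≡b : q ∘ (s ∘ (p ∘ a)) ≡ b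
        qspa≡b = begin
          q ∘ (s ∘ (p ∘ a))        ≡⟨ sym (trans assoc (cong (q ∘_) assoc)) ⟩
          (q ∘ (s ∘ p)) ∘ a        ≡⟨ sym (pullˡ (p₂∘mediator Ũ×Ũ.isPullback πq≡πqsp)) ⟩
          Ũ×Ũ.p₂ ∘ (⟨q,qsp⟩ ∘ a)   ≡⟨ cong (Ũ×Ũ.p₂ ∘_) sq ⟩
          Ũ×Ũ.p₂ ∘ (Δ ∘ b)         ≡⟨ cancelˡ p₂∘diagonal ⟩
          b                        ∎

        spa≡a : s ∘ (p ∘ a) ≡ a
        spa≡a = IsPullback⇒JointlyMonic fib (cancelˡ ps≡id) (trans qspa≡b (sym qa≡b))

      section-isPullback-diagonal : IsPullback 𝒞 ⟨q,qsp⟩ Δ s (q ∘ s)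
      section-isPullback-diagonal = IsPullback-intro ⟨q,qsp⟩∘s≡Δ∘qs
        (λ a b sq → p ∘ a , spa≡a sq , trans assoc (trans (cong (q ∘_) (spa≡a sq)) (qa≡b sq)))
        (λ su≡sv _ → section⇒Mono ps≡id _ _ su≡sv)

    section-isPullbackOf-diagonal : ∀ {E B} {p : Hom E B} {s : Hom B E} →
                                    IsFibration 𝒞 π p → p ∘ s ≡ id → IsPullbackOf Δ s
    section-isPullbackOf-diagonal (_ , _ , fib) ps≡id =
      _ , _ , section-isPullback-diagonal fib ps≡id

corollary2p17 : ∀ {o ℓ} (𝒞 : Category o ℓ) (lccc : LCCC 𝒞) →
    let open Category 𝒞 in
    ∀ {Ũ U ∂Cof Cof : Obj} (π : Hom Ũ U) (ι : Hom ∂Cof Cof) →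
    Mono 𝒞 ι →
    CofibrantStructure 𝒞 lccc π ι →
    ∀ {E B : Obj} (p : Hom E B) → IsFibration 𝒞 π p →
    (s : Hom B E) → p ∘ s ≡ id →
    IsCofibration 𝒞 ι s
-- ι need not be monic: pullback squares paste along arbitrary maps.
corollary2p17 𝒞 lccc π ι _ cs p fib s ps≡id =
  IsPullbackOf-trans 𝒞 (isEq , eq , isPullback) (section-isPullbackOf-diagonal 𝒞 lccc π fib ps≡id)
  where open CofibrantStructure cs
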